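{- For $n\ge 3$ let $y_n=\lceil 2^n/24\rceil/2^n$ and $p_n=\frac12-y_n$. Then $m_n(y_n)-2y_n=\frac18$ and $m_n(p_n)=\frac58$.
   Context: For $x\in[0,1]$ define $\Delta_1(x)=\frac12-|x-\frac12|$ and, for $n\ge2$, $\Delta_n(x)=\frac12\Delta_{n-1}(2x-\lfloor 2x\rfloor)$. Define $m_n(x)=\sum_{i=1}^n\Delta_i(x)$. -}

module Defs where

open import Data.Nat using (ℕ; zero; suc; _^_)
open import Data.Nat.Properties using (m^n≢0)
open import Data.Integer using (ℤ; +_)
open import Data.Rational using (ℚ; _/_; _+_; _-_; _*_; ∣_∣; ½; 0ℚ; floor; ceiling)

ℤ→ℚ : ℤ → ℚ
ℤ→ℚ z = z / 1

frac : ℚ → ℚ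
frac x = x - ℤ→ℚ (floor x)

Δ : ℕ → ℚ → ℚ
Δ zero x = 0ℚ                 -- unused (paper's index starts at 1)
Δ (suc zero) x = ½ - ∣ x - ½ ∣
Δ (suc (suc n)) x = ½ * Δ (suc n) (frac ((+ 2 / 1) * x))

m : ℕ → ℚ → ℚ
m zero x = 0ℚ
m (suc n) x = m n x + Δ (suc n) x

y : ℕ → ℚ
y n = _/_ (ceiling ((+ (2 ^ n)) / 24)) (2 ^ n) {{m^n≢0 2 n}}

p : ℕ → ℚ
p n = ½ - y n

-- Let T x = frac (2x) be the doubling map. Since Δ (k+1) x = ½ Δ k (T x), we get
-- m (n+1) x = Δ₁ x + ½ m n (T x), which reads x + ½ m n (2x) on [0,½) and (1-x) + ½ m n (2x-1) on [½,1).
-- Put u k = ⌈2^k/3⌉/2^k (⅓↑ below), so that y (k+3) = u k / 8 and u (k+2) = (u k + 1)/4. Two steps of the recursion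
-- (first branch, then second) carry u (k+2) back to u k, giving m k (u k) = 1 - u k by induction; three steps
-- of the first branch give m (k+3) (u/8) = 3u/8 + m k u / 8, hence m n (y n) - 2 y n = 1/8.
-- Finally, m n is symmetric under x ↦ 1 - x, and applying the recursion to ½ + y = 1 - p gives
-- m n (p n) = m n (y n) + ½ - 2 y n = 5/8.
module Submission where

open import Defs
open import Data.Bool using (T)
open import Data.Maybe using (Maybe; just; nothing)
open import Data.Nat as ℕ using (ℕ; zero; suc; _^_; s≤s; z≤n)
import Data.Nat.Properties as ℕ
open import Data.Nat.Tactic.RingSolver using () renaming (solve-∀ to ℕ-solve-∀)
import Data.Nat.Coprimality as Coprime
open import Data.Integer as ℤ using (ℤ; +_; -[1+_])
import Data.Integer.Properties as ℤ
import Data.Integer.DivMod as ℤ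
open import Data.Rational
  using (ℚ; mkℚ; _/_; _+_; _-_; _*_; -_; ∣_∣; 0ℚ; 1ℚ; ½; floor; ceiling; _≤_; _<_; _≤ᵇ_; *≤*; *<*; Positive; toℚᵘ)
import Data.Rational.Properties as ℚ
open import Data.Rational.Unnormalised as ℚᵘ using (mkℚᵘ) renaming (_/_ to _ᵘ/_; _≃_ to _≃ᵘ_)
import Data.Rational.Unnormalised.Properties as ℚᵘ
open import Data.Product using (_×_; _,_; proj₁; proj₂)
open import Relation.Nullary using (yes; no)
open import Relation.Binary.Definitions using (tri<; tri≈; tri>)
open import Relation.Binary.PropositionalEquality
open import Tactic.RingSolver using (solve-∀)
open import Tactic.RingSolver.Core.AlmostCommutativeRing using (AlmostCommutativeRing; fromCommutativeRing)

ℚ-ring : AlmostCommutativeRing _ _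
ℚ-ring = fromCommutativeRing ℚ.+-*-commutativeRing isZero
  where
  isZero : ∀ x → Maybe (0ℚ ≡ x)
  isZero x with 0ℚ ℚ.≟ x
  ... | yes 0≡x = just 0≡x
  ... | no _    = nothing

2ℚ ¼ ⅛ : ℚ
2ℚ = + 2 / 1
¼  = + 1 / 4
⅛  = + 1 / 8

½<1 : ½ < 1ℚ
½<1 = *<* (ℤ.+<+ (s≤s (s≤s z≤n)))

c-[c-x]≡x : ∀ c x → c - (c - x) ≡ x
c-[c-x]≡x = solve-∀ ℚ-ring

-‿monoʳ-< : ∀ c {x y} → x < y → c - y < c - x
-‿monoʳ-< c x<y = ℚ.+-monoʳ-< c (ℚ.neg-antimono-< x<y)

-‿monoʳ-≤ : ∀ c {x y} → x ≤ y → c - y ≤ c - x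
-‿monoʳ-≤ c x≤y = ℚ.+-monoʳ-≤ c (ℚ.neg-antimono-≤ x≤y)

p≤q⇒0≤q-p : ∀ {p q} → p ≤ q → 0ℚ ≤ q - p
p≤q⇒0≤q-p {p} {q} p≤q = subst (_≤ q - p) (ℚ.+-inverseʳ p) (ℚ.+-monoˡ-≤ (- p) p≤q)

infix 4 _∈[_,_⟩
_∈[_,_⟩ : ℚ → ℚ → ℚ → Set
x ∈[ l , u ⟩ = l ≤ x × x < u

*-mono-∈ : ∀ a .{{_ : Positive a}} {x l u} → x ∈[ l , u ⟩ → a * x ∈[ a * l , a * u ⟩
*-mono-∈ a (l≤x , x<u) = ℚ.*-monoˡ-≤-nonNeg a {{ℚ.pos⇒nonNeg a}} l≤x , ℚ.*-monoʳ-<-pos a x<u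

+1-mono-∈ : ∀ {x l u} → x ∈[ l , u ⟩ → x + 1ℚ ∈[ l + 1ℚ , u + 1ℚ ⟩
+1-mono-∈ (l≤x , x<u) = ℚ.+-monoˡ-≤ 1ℚ l≤x , ℚ.+-monoˡ-< 1ℚ x<u

∈-weaken : ∀ {x l u l′ u′} → T (l′ ≤ᵇ l) → T (u ≤ᵇ u′) → x ∈[ l , u ⟩ → x ∈[ l′ , u′ ⟩
∈-weaken l′≤l u≤u′ (l≤x , x<u) = ℚ.≤-trans (ℚ.≤ᵇ⇒≤ l′≤l) l≤x , ℚ.<-≤-trans x<u (ℚ.≤ᵇ⇒≤ u≤u′)

-- Floor, ceiling and fractional part

-- The value of ℤ→ℚ j, written as mkℚ j 0 so that comparisons with it unfold to integer inequalities.
fromℤ : ℤ → ℚ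
fromℤ j = mkℚ j 0 (Coprime.sym (Coprime.1-coprimeTo _))

fromℤ-cancel-< : ∀ {i j} → fromℤ i < fromℤ j → i ℤ.< j
fromℤ-cancel-< {i} {j} (*<* i*1<j*1) = subst₂ ℤ._<_ (ℤ.*-identityʳ i) (ℤ.*-identityʳ j) i*1<j*1

fromℤ-floor≤ : ∀ x → fromℤ (floor x) ≤ x
fromℤ-floor≤ (mkℚ n d-1 _) = *≤* (subst ((n ℤ./ + suc d-1) ℤ.* + suc d-1 ℤ.≤_) (sym (ℤ.*-identityʳ n))
  (ℤ.[n/d]*d≤n n (+ suc d-1)))

<fromℤ-suc-floor : ∀ x → x < fromℤ (ℤ.suc (floor x))
<fromℤ-suc-floor (mkℚ n d-1 _) = *<* (subst₂ ℤ._<_ (sym (ℤ.*-identityʳ n))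
  (cong (λ q → ℤ.suc q ℤ.* + suc d-1) (sym (ℤ.div-pos-is-/ℕ n (suc d-1)))) (ℤ.n<s[n/ℕd]*d n (suc d-1)))

floor-unique : ∀ {x} j → fromℤ j ≤ x → x < fromℤ (ℤ.suc j) → floor x ≡ j
floor-unique {x} j j≤x x<j+1 = ℤ.≤-antisym
  (<-suc⇒≤ (fromℤ-cancel-< (ℚ.≤-<-trans (fromℤ-floor≤ x) x<j+1)))
  (<-suc⇒≤ (fromℤ-cancel-< (ℚ.≤-<-trans j≤x (<fromℤ-suc-floor x))))
  where
  <-suc⇒≤ : ∀ {i k} → i ℤ.< ℤ.suc k → i ℤ.≤ k
  <-suc⇒≤ {k = k} i<k+1 = subst (_ ℤ.≤_) (ℤ.pred-suc k) (ℤ.i<j⇒i≤pred[j] i<k+1)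

ceiling-unique : ∀ {x} c → fromℤ (+ c) < x → x ≤ fromℤ (+ suc c) → ceiling x ≡ + suc c
ceiling-unique {x@record{}} c c<x x≤c+1 = cong ℤ.-_
  (floor-unique -[1+ c ] (ℚ.neg-antimono-≤ x≤c+1) (subst (- x <_) (neg-fromℤ c) (ℚ.neg-antimono-< c<x)))
  where
  neg-fromℤ : ∀ c → - fromℤ (+ c) ≡ fromℤ (ℤ.suc -[1+ c ])
  neg-fromℤ zero    = refl
  neg-fromℤ (suc _) = refl

frac-∈[0,1⟩ : ∀ {x} → x ∈[ 0ℚ , 1ℚ ⟩ → frac x ≡ x
frac-∈[0,1⟩ {x} (0≤x , x<1) rewrite floor-unique (+ 0) 0≤x x<1 = ℚ.+-identityʳ x

frac-∈[1,2⟩ : ∀ {x} → x ∈[ 1ℚ , 2ℚ ⟩ → frac x ≡ x - 1ℚ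
frac-∈[1,2⟩ (1≤x , x<2) rewrite floor-unique (+ 1) 1≤x x<2 = refl

-- Fractions with natural denominators

toℚᵘ-/ : ∀ i n .{{_ : ℕ.NonZero n}} → toℚᵘ (i / n) ≃ᵘ (i ᵘ/ n)
toℚᵘ-/ i (suc d) = ℚ.toℚᵘ-fromℚᵘ (mkℚᵘ i d)

/-*-/ : ∀ i j m n .{{_ : ℕ.NonZero m}} .{{_ : ℕ.NonZero n}} →
        (i / m) * (j / n) ≡ ((i ℤ.* j) / (m ℕ.* n)) {{ℕ.m*n≢0 m n}}
/-*-/ i j m@(suc _) n@(suc _) = ℚ.toℚᵘ-injective (ℚᵘ.≃-trans (ℚ.toℚᵘ-homo-* (i / m) (j / n))
  (ℚᵘ.≃-trans (ℚᵘ.*-cong (toℚᵘ-/ i m) (toℚᵘ-/ j n)) (ℚᵘ.≃-sym (toℚᵘ-/ (i ℤ.* j) (m ℕ.* n)))))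

/-+-/ : ∀ i j m n .{{_ : ℕ.NonZero m}} .{{_ : ℕ.NonZero n}} →
        (i / m) + (j / n) ≡ ((i ℤ.* + n ℤ.+ j ℤ.* + m) / (m ℕ.* n)) {{ℕ.m*n≢0 m n}}
/-+-/ i j m@(suc _) n@(suc _) = ℚ.toℚᵘ-injective (ℚᵘ.≃-trans (ℚ.toℚᵘ-homo-+ (i / m) (j / n))
  (ℚᵘ.≃-trans (ℚᵘ.+-cong (toℚᵘ-/ i m) (toℚᵘ-/ j n)) (ℚᵘ.≃-sym (toℚᵘ-/ (i ℤ.* + n ℤ.+ j ℤ.* + m) (m ℕ.* n)))))

fromℤ</ : ∀ {c n} d .{{_ : ℕ.NonZero d}} → c ℕ.* d ℕ.< n → fromℤ (+ c) < + n / d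
fromℤ</ {c} {n} d@(suc _) c*d<n = ℚ.toℚᵘ-cancel-< (ℚᵘ.<-respʳ-≃ (ℚᵘ.≃-sym (toℚᵘ-/ (+ n) d))
  (ℚᵘ.*<* (subst₂ ℤ._<_ (ℤ.pos-* c d) (sym (ℤ.*-identityʳ (+ n))) (ℤ.+<+ c*d<n))))

/≤fromℤ : ∀ {c n} d .{{_ : ℕ.NonZero d}} → n ℕ.≤ c ℕ.* d → + n / d ≤ fromℤ (+ c)
/≤fromℤ {c} {n} d@(suc _) n≤c*d = ℚ.toℚᵘ-cancel-≤ (ℚᵘ.≤-respˡ-≃ (ℚᵘ.≃-sym (toℚᵘ-/ (+ n) d))
  (ℚᵘ.*≤* (subst₂ ℤ._≤_ (sym (ℤ.*-identityʳ (+ n))) (ℤ.pos-* c d) (ℤ.+≤+ n≤c*d))))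

ceiling-/ : ∀ n d c .{{_ : ℕ.NonZero d}} → c ℕ.* d ℕ.< n → n ℕ.≤ suc c ℕ.* d → ceiling (+ n / d) ≡ + suc c
ceiling-/ n d c c*d<n n≤[c+1]*d = ceiling-unique c (fromℤ</ d c*d<n) (/≤fromℤ d n≤[c+1]*d)

infixl 7 _/2^_
_/2^_ : ℤ → ℕ → ℚ
i /2^ k = (i / 2 ^ k) {{ℕ.m^n≢0 2 k}}

/2^-*-/2^ : ∀ i i′ j k → (i /2^ j) * (i′ /2^ k) ≡ (i ℤ.* i′) /2^ (j ℕ.+ k)
/2^-*-/2^ i i′ j k = trans (/-*-/ i i′ (2 ^ j) (2 ^ k) {{ℕ.m^n≢0 2 j}} {{ℕ.m^n≢0 2 k}})
  (ℚ./-cong {{ℕ.m*n≢0 (2 ^ j) (2 ^ k) {{ℕ.m^n≢0 2 j}} {{ℕ.m^n≢0 2 k}}}} {{ℕ.m^n≢0 2 (j ℕ.+ k)}}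
    (refl {x = i ℤ.* i′}) (sym (ℕ.^-distribˡ-+-* 2 j k)))

/2^-+1 : ∀ i k → i /2^ k + 1ℚ ≡ (i ℤ.+ + (2 ^ k)) /2^ k
/2^-+1 i k = trans (/-+-/ i (+ 1) (2 ^ k) 1 {{ℕ.m^n≢0 2 k}})
  (ℚ./-cong {{ℕ.m*n≢0 (2 ^ k) 1 {{ℕ.m^n≢0 2 k}}}} {{ℕ.m^n≢0 2 k}}
    (cong₂ ℤ._+_ (ℤ.*-identityʳ i) (ℤ.*-identityˡ (+ (2 ^ k)))) (ℕ.*-identityʳ (2 ^ k)))

-- The recursion for m

Δ₁-lower : ∀ {x} → x ≤ ½ → Δ 1 x ≡ x
Δ₁-lower {x} x≤½ = begin
  ½ - ∣ x - ½ ∣       ≡⟨ cong (λ t → ½ - ∣ t ∣) (x-½≡-[½-x] x) ⟩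
  ½ - ∣ - (½ - x) ∣   ≡⟨ cong (λ t → ½ - t) (ℚ.∣-p∣≡∣p∣ (½ - x)) ⟩
  ½ - ∣ ½ - x ∣       ≡⟨ cong (λ t → ½ - t) (ℚ.0≤p⇒∣p∣≡p (p≤q⇒0≤q-p x≤½)) ⟩
  ½ - (½ - x)         ≡⟨ c-[c-x]≡x ½ x ⟩
  x                   ∎
  where
  open ≡-Reasoning
  x-½≡-[½-x] : ∀ x → x - ½ ≡ - (½ - x)
  x-½≡-[½-x] = solve-∀ ℚ-ring

Δ₁-upper : ∀ {x} → ½ ≤ x → Δ 1 x ≡ 1ℚ - x
Δ₁-upper {x} ½≤x = begin
  ½ - ∣ x - ½ ∣       ≡⟨ cong (λ t → ½ - t) (ℚ.0≤p⇒∣p∣≡p (p≤q⇒0≤q-p ½≤x)) ⟩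
  ½ - (x - ½)         ≡⟨ ½-[x-½]≡1-x x ⟩
  1ℚ - x              ∎
  where
  open ≡-Reasoning
  ½-[x-½]≡1-x : ∀ x → ½ - (x - ½) ≡ 1ℚ - x
  ½-[x-½]≡1-x = solve-∀ ℚ-ring

m-suc : ∀ n x → m (suc n) x ≡ Δ 1 x + ½ * m n (frac (2ℚ * x))
m-suc zero    x = ℚ.+-comm 0ℚ (Δ 1 x)
m-suc (suc n) x = begin
  m (suc n) x + Δ (suc (suc n)) x
    ≡⟨ cong (_+ Δ (suc (suc n)) x) (m-suc n x) ⟩
  Δ 1 x + ½ * m n Tx + ½ * Δ (suc n) Tx
    ≡⟨ ℚ.+-assoc (Δ 1 x) (½ * m n Tx) (½ * Δ (suc n) Tx) ⟩
  Δ 1 x + (½ * m n Tx + ½ * Δ (suc n) Tx)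
    ≡⟨ cong (λ t → Δ 1 x + t) (ℚ.*-distribˡ-+ ½ (m n Tx) (Δ (suc n) Tx)) ⟨
  Δ 1 x + ½ * (m n Tx + Δ (suc n) Tx)
    ∎
  where
  open ≡-Reasoning
  Tx = frac (2ℚ * x)

m-suc-lower : ∀ n {x} → x ∈[ 0ℚ , ½ ⟩ → m (suc n) x ≡ x + ½ * m n (2ℚ * x)
m-suc-lower n {x} x∈@(_ , x<½) = trans (m-suc n x)
  (cong₂ (λ a b → a + ½ * m n b) (Δ₁-lower (ℚ.<⇒≤ x<½)) (frac-∈[0,1⟩ (*-mono-∈ 2ℚ x∈)))

m-suc-upper : ∀ n {x} → x ∈[ ½ , 1ℚ ⟩ → m (suc n) x ≡ (1ℚ - x) + ½ * m n (2ℚ * x - 1ℚ)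
m-suc-upper n {x} x∈@(½≤x , _) = trans (m-suc n x)
  (cong₂ (λ a b → a + ½ * m n b) (Δ₁-upper ½≤x) (frac-∈[1,2⟩ (*-mono-∈ 2ℚ x∈)))

m-suc-lower-scaled : ∀ n a v → a * v ∈[ 0ℚ , ½ ⟩ → m (suc n) (a * v) ≡ a * v + ½ * m n ((2ℚ * a) * v)
m-suc-lower-scaled n a v av∈ =
  trans (m-suc-lower n av∈) (cong (λ t → a * v + ½ * m n t) (sym (ℚ.*-assoc 2ℚ a v)))

m-suc-upper-scaled : ∀ n a v → a * v ∈[ ½ , 1ℚ ⟩ →
                     m (suc n) (a * v) ≡ (1ℚ - a * v) + ½ * m n ((2ℚ * a) * v - 1ℚ)
m-suc-upper-scaled n a v av∈ =
  trans (m-suc-upper n av∈) (cong (λ t → (1ℚ - a * v) + ½ * m n (t - 1ℚ)) (sym (ℚ.*-assoc 2ℚ a v)))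

ReflectionSymmetric : ℕ → Set
ReflectionSymmetric n = ∀ {x} → 0ℚ < x → x < 1ℚ → m n (1ℚ - x) ≡ m n x

m-suc-reflect-lower : ∀ n → ReflectionSymmetric n →
                      ∀ {x} → 0ℚ < x → x < ½ → m (suc n) (1ℚ - x) ≡ m (suc n) x
m-suc-reflect-lower n symm {x} 0<x x<½ = begin
  m (suc n) (1ℚ - x)
    ≡⟨ m-suc-upper n (-‿monoʳ-≤ 1ℚ (ℚ.<⇒≤ x<½) , -‿monoʳ-< 1ℚ 0<x) ⟩
  (1ℚ - (1ℚ - x)) + ½ * m n (2ℚ * (1ℚ - x) - 1ℚ)
    ≡⟨ cong₂ (λ a b → a + ½ * m n b) (c-[c-x]≡x 1ℚ x) (2[1-x]-1≡1-2x x) ⟩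
  x + ½ * m n (1ℚ - 2ℚ * x)
    ≡⟨ cong (λ t → x + ½ * t) (symm (ℚ.*-monoʳ-<-pos 2ℚ 0<x) (ℚ.*-monoʳ-<-pos 2ℚ x<½)) ⟩
  x + ½ * m n (2ℚ * x)
    ≡⟨ m-suc-lower n (ℚ.<⇒≤ 0<x , x<½) ⟨
  m (suc n) x
    ∎
  where
  open ≡-Reasoning
  2[1-x]-1≡1-2x : ∀ x → 2ℚ * (1ℚ - x) - 1ℚ ≡ 1ℚ - 2ℚ * x
  2[1-x]-1≡1-2x = solve-∀ ℚ-ring

m-reflect : ∀ n → ReflectionSymmetric n
m-reflect zero    _   _   = refl
m-reflect (suc n) {x} 0<x x<1 with ℚ.<-cmp x ½
... | tri< x<½ _ _  = m-suc-reflect-lower n (m-reflect n) 0<x x<½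
... | tri≈ _ refl _ = refl
... | tri> _ _ ½<x  = begin
  m (suc n) (1ℚ - x)           ≡⟨ m-suc-reflect-lower n (m-reflect n) (-‿monoʳ-< 1ℚ x<1) (-‿monoʳ-< 1ℚ ½<x) ⟨
  m (suc n) (1ℚ - (1ℚ - x))    ≡⟨ cong (m (suc n)) (c-[c-x]≡x 1ℚ x) ⟩
  m (suc n) x                  ∎
  where open ≡-Reasoning

m-[½-x] : ∀ n {x} → x ∈[ 0ℚ , ½ ⟩ → m (suc n) (½ - x) ≡ m (suc n) x + (½ - 2ℚ * x)
m-[½-x] n {x} x∈@(0≤x , x<½) = begin
  m (suc n) (½ - x)
    ≡⟨ m-reflect (suc n) (-‿monoʳ-< ½ x<½) (ℚ.≤-<-trans (-‿monoʳ-≤ ½ 0≤x) ½<1) ⟨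
  m (suc n) (1ℚ - (½ - x))
    ≡⟨ cong (m (suc n)) (1-[½-x]≡½+x x) ⟩
  m (suc n) (½ + x)
    ≡⟨ m-suc-upper n (ℚ.+-monoʳ-≤ ½ 0≤x , ℚ.+-monoʳ-< ½ x<½) ⟩
  (1ℚ - (½ + x)) + ½ * m n (2ℚ * (½ + x) - 1ℚ)
    ≡⟨ cong (λ t → (1ℚ - (½ + x)) + ½ * m n t) (2[½+x]-1≡2x x) ⟩
  (1ℚ - (½ + x)) + ½ * m n (2ℚ * x)
    ≡⟨ regroup x (m n (2ℚ * x)) ⟩
  (x + ½ * m n (2ℚ * x)) + (½ - 2ℚ * x)
    ≡⟨ cong (_+ (½ - 2ℚ * x)) (m-suc-lower n x∈) ⟨
  m (suc n) x + (½ - 2ℚ * x)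
    ∎
  where
  open ≡-Reasoning
  1-[½-x]≡½+x : ∀ x → 1ℚ - (½ - x) ≡ ½ + x
  1-[½-x]≡½+x = solve-∀ ℚ-ring
  2[½+x]-1≡2x : ∀ x → 2ℚ * (½ + x) - 1ℚ ≡ 2ℚ * x
  2[½+x]-1≡2x = solve-∀ ℚ-ring
  regroup : ∀ x y → (1ℚ - (½ + x)) + ½ * y ≡ (x + ½ * y) + (½ - 2ℚ * x)
  regroup = solve-∀ ℚ-ring

m-⅛* : ∀ k {x} → x ∈[ 0ℚ , 1ℚ ⟩ → m (3 ℕ.+ k) (⅛ * x) ≡ (+ 3 / 8) * x + ⅛ * m k x
m-⅛* k {x} x∈ = begin
  m (3 ℕ.+ k) (⅛ * x)
    ≡⟨ m-suc-lower-scaled (2 ℕ.+ k) ⅛ x ⅛x∈ ⟩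
  ⅛ * x + ½ * m (2 ℕ.+ k) (¼ * x)
    ≡⟨ cong (λ t → ⅛ * x + ½ * t) (m-suc-lower-scaled (1 ℕ.+ k) ¼ x ¼x∈) ⟩
  ⅛ * x + ½ * (¼ * x + ½ * m (1 ℕ.+ k) (½ * x))
    ≡⟨ cong (λ t → ⅛ * x + ½ * (¼ * x + ½ * t)) (m-suc-lower-scaled k ½ x ½x∈) ⟩
  ⅛ * x + ½ * (¼ * x + ½ * (½ * x + ½ * m k (1ℚ * x)))
    ≡⟨ cong (λ t → ⅛ * x + ½ * (¼ * x + ½ * (½ * x + ½ * m k t))) (ℚ.*-identityˡ x) ⟩
  ⅛ * x + ½ * (¼ * x + ½ * (½ * x + ½ * m k x))
    ≡⟨ collect x (m k x) ⟩
  (+ 3 / 8) * x + ⅛ * m k x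
    ∎
  where
  open ≡-Reasoning
  ⅛x∈ : ⅛ * x ∈[ 0ℚ , ½ ⟩
  ⅛x∈ = ∈-weaken _ _ (*-mono-∈ ⅛ x∈)
  ¼x∈ : ¼ * x ∈[ 0ℚ , ½ ⟩
  ¼x∈ = ∈-weaken _ _ (*-mono-∈ ¼ x∈)
  ½x∈ : ½ * x ∈[ 0ℚ , ½ ⟩
  ½x∈ = *-mono-∈ ½ x∈
  collect : ∀ x y → ⅛ * x + ½ * (¼ * x + ½ * (½ * x + ½ * y)) ≡ (+ 3 / 8) * x + ⅛ * y
  collect = solve-∀ ℚ-ring

-- The points ⅓↑ k and the values y n

-- 1/3 rounded up to k binary digits (see ⅓↑-closed).
⅓↑ : ℕ → ℚ
⅓↑ 0               = 1ℚ
⅓↑ 1               = ½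
⅓↑ (suc (suc k))   = ¼ * (⅓↑ k + 1ℚ)

⅓↑-∈ : ∀ k → ⅓↑ (suc k) ∈[ 0ℚ , 1ℚ ⟩
⅓↑-∈ zero          = ℚ.≤ᵇ⇒≤ _ , ½<1
⅓↑-∈ (suc zero)    = ⅓↑-∈ zero
⅓↑-∈ (suc (suc k)) = ∈-weaken _ _ (*-mono-∈ ¼ (+1-mono-∈ (⅓↑-∈ k)))

m-⅓↑ : ∀ k → m k (⅓↑ k) ≡ 1ℚ - ⅓↑ k
m-⅓↑ 0 = refl
m-⅓↑ 1 = refl
m-⅓↑ 2 = refl
m-⅓↑ (suc (suc (suc k))) = begin
  m (3 ℕ.+ k) (¼ * v)
    ≡⟨ m-suc-lower-scaled (2 ℕ.+ k) ¼ v ¼v∈ ⟩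
  ¼ * v + ½ * m (2 ℕ.+ k) (½ * v)
    ≡⟨ cong (λ t → ¼ * v + ½ * t) (m-suc-upper-scaled (1 ℕ.+ k) ½ v ½v∈) ⟩
  ¼ * v + ½ * ((1ℚ - ½ * v) + ½ * m (1 ℕ.+ k) (1ℚ * v - 1ℚ))
    ≡⟨ cong (λ t → ¼ * v + ½ * ((1ℚ - ½ * v) + ½ * m (1 ℕ.+ k) t)) (1[x+1]-1≡x u) ⟩
  ¼ * v + ½ * ((1ℚ - ½ * v) + ½ * m (1 ℕ.+ k) u)
    ≡⟨ cong (λ t → ¼ * v + ½ * ((1ℚ - ½ * v) + ½ * t)) (m-⅓↑ (suc k)) ⟩
  ¼ * v + ½ * ((1ℚ - ½ * v) + ½ * (1ℚ - u))
    ≡⟨ collect u ⟩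
  1ℚ - ¼ * v
    ∎
  where
  open ≡-Reasoning
  u  = ⅓↑ (suc k)
  v  = u + 1ℚ
  ¼v∈ : ¼ * v ∈[ 0ℚ , ½ ⟩
  ¼v∈ = ∈-weaken _ _ (*-mono-∈ ¼ (+1-mono-∈ (⅓↑-∈ k)))
  ½v∈ : ½ * v ∈[ ½ , 1ℚ ⟩
  ½v∈ = *-mono-∈ ½ (+1-mono-∈ (⅓↑-∈ k))
  1[x+1]-1≡x : ∀ x → 1ℚ * (x + 1ℚ) - 1ℚ ≡ x
  1[x+1]-1≡x = solve-∀ ℚ-ring
  collect : ∀ x → ¼ * (x + 1ℚ) + ½ * ((1ℚ - ½ * (x + 1ℚ)) + ½ * (1ℚ - x)) ≡ 1ℚ - ¼ * (x + 1ℚ)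
  collect = solve-∀ ℚ-ring

⌊2^_/3⌋ : ℕ → ℕ
⌊2^ 0 /3⌋             = 0
⌊2^ 1 /3⌋             = 0
⌊2^ suc (suc k) /3⌋   = ⌊2^ k /3⌋ ℕ.+ 2 ^ k

-- Ceiling-style bounds: since 3 ∤ 2^k, ⌈2^k/3⌉ = ⌊2^k/3⌋ + 1.
⌊2^k/3⌋-bounds : ∀ k → ⌊2^ k /3⌋ ℕ.* 3 ℕ.< 2 ^ k × 2 ^ k ℕ.≤ suc ⌊2^ k /3⌋ ℕ.* 3
⌊2^k/3⌋-bounds 0 = s≤s z≤n , s≤s z≤n
⌊2^k/3⌋-bounds 1 = s≤s z≤n , s≤s (s≤s z≤n)
⌊2^k/3⌋-bounds (suc (suc k)) with ⌊2^k/3⌋-bounds k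
... | lower , upper =
  subst₂ ℕ._<_ (split ⌊2^ k /3⌋ (2 ^ k)) (sym (quadruple (2 ^ k))) (ℕ.+-monoˡ-< (2 ^ k ℕ.* 3) lower) ,
  subst₂ ℕ._≤_ (sym (quadruple (2 ^ k))) (split (suc ⌊2^ k /3⌋) (2 ^ k)) (ℕ.+-monoˡ-≤ (2 ^ k ℕ.* 3) upper)
  where
  split : ∀ a x → a ℕ.* 3 ℕ.+ x ℕ.* 3 ≡ (a ℕ.+ x) ℕ.* 3
  split = ℕ-solve-∀
  quadruple : ∀ x → 2 ℕ.* (2 ℕ.* x) ≡ x ℕ.+ x ℕ.* 3
  quadruple = ℕ-solve-∀

⅓↑-closed : ∀ k → ⅓↑ k ≡ + suc ⌊2^ k /3⌋ /2^ k
⅓↑-closed 0 = refl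
⅓↑-closed 1 = refl
⅓↑-closed (suc (suc k)) = begin
  ¼ * (⅓↑ k + 1ℚ)                        ≡⟨ cong (λ t → ¼ * (t + 1ℚ)) (⅓↑-closed k) ⟩
  ¼ * (+ c /2^ k + 1ℚ)                   ≡⟨ cong (¼ *_) (/2^-+1 (+ c) k) ⟩
  ¼ * ((+ c ℤ.+ + X) /2^ k)              ≡⟨ /2^-*-/2^ (+ 1) (+ c ℤ.+ + X) 2 k ⟩
  (+ 1 ℤ.* (+ c ℤ.+ + X)) /2^ (2 ℕ.+ k)  ≡⟨ cong (_/2^ (2 ℕ.+ k)) (trans (ℤ.*-identityˡ _) (sym (ℤ.pos-+ c X))) ⟩
  + (c ℕ.+ X) /2^ (2 ℕ.+ k)              ∎
  where
  open ≡-Reasoning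
  c = suc ⌊2^ k /3⌋
  X = 2 ^ k

y≡⅛*⅓↑ : ∀ k → y (3 ℕ.+ k) ≡ ⅛ * ⅓↑ k
y≡⅛*⅓↑ k = begin
  y (3 ℕ.+ k)                    ≡⟨ cong (_/2^ (3 ℕ.+ k)) (ceiling-/ _ 24 ⌊2^ k /3⌋ lower upper) ⟩
  + c /2^ (3 ℕ.+ k)              ≡⟨ cong (_/2^ (3 ℕ.+ k)) (ℤ.*-identityˡ (+ c)) ⟨
  (+ 1 ℤ.* + c) /2^ (3 ℕ.+ k)    ≡⟨ /2^-*-/2^ (+ 1) (+ c) 3 k ⟨
  ⅛ * (+ c /2^ k)                ≡⟨ cong (⅛ *_) (⅓↑-closed k) ⟨
  ⅛ * ⅓↑ k                       ∎
  where
  open ≡-Reasoning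
  c = suc ⌊2^ k /3⌋
  octuple : ∀ x → 8 ℕ.* x ≡ 2 ℕ.* (2 ℕ.* (2 ℕ.* x))
  octuple = ℕ-solve-∀
  scale : ∀ a → 8 ℕ.* (a ℕ.* 3) ≡ a ℕ.* 24
  scale = ℕ-solve-∀
  lower : ⌊2^ k /3⌋ ℕ.* 24 ℕ.< 2 ^ (3 ℕ.+ k)
  lower = subst₂ ℕ._<_ (scale ⌊2^ k /3⌋) (octuple (2 ^ k)) (ℕ.*-monoʳ-< 8 (proj₁ (⌊2^k/3⌋-bounds k)))
  upper : 2 ^ (3 ℕ.+ k) ℕ.≤ c ℕ.* 24
  upper = subst₂ ℕ._≤_ (octuple (2 ^ k)) (scale c) (ℕ.*-monoʳ-≤ 8 (proj₂ (⌊2^k/3⌋-bounds k)))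

m-y-2y : ∀ k → m (4 ℕ.+ k) (y (4 ℕ.+ k)) - 2ℚ * y (4 ℕ.+ k) ≡ ⅛
m-y-2y k = begin
  m (4 ℕ.+ k) (y (4 ℕ.+ k)) - 2ℚ * y (4 ℕ.+ k)
    ≡⟨ cong (λ t → m (4 ℕ.+ k) t - 2ℚ * t) (y≡⅛*⅓↑ (suc k)) ⟩
  m (4 ℕ.+ k) (⅛ * u) - 2ℚ * (⅛ * u)
    ≡⟨ cong (_- 2ℚ * (⅛ * u)) (m-⅛* (suc k) (⅓↑-∈ k)) ⟩
  (+ 3 / 8) * u + ⅛ * m (suc k) u - 2ℚ * (⅛ * u)
    ≡⟨ cong (λ t → (+ 3 / 8) * u + ⅛ * t - 2ℚ * (⅛ * u)) (m-⅓↑ (suc k)) ⟩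
  (+ 3 / 8) * u + ⅛ * (1ℚ - u) - 2ℚ * (⅛ * u)
    ≡⟨ cancel u ⟩
  ⅛
    ∎
  where
  open ≡-Reasoning
  u = ⅓↑ (suc k)
  cancel : ∀ x → (+ 3 / 8) * x + ⅛ * (1ℚ - x) - 2ℚ * (⅛ * x) ≡ ⅛
  cancel = solve-∀ ℚ-ring

y∈[0,½⟩ : ∀ k → y (4 ℕ.+ k) ∈[ 0ℚ , ½ ⟩
y∈[0,½⟩ k = subst (_∈[ 0ℚ , ½ ⟩) (sym (y≡⅛*⅓↑ (suc k))) (∈-weaken _ _ (*-mono-∈ ⅛ (⅓↑-∈ k)))

corollary4p5 : ∀ (n : ℕ) → 3 ℕ.≤ n →
    (m n (y n) - (+ 2 / 1) * y n ≡ + 1 / 8) × (m n (p n) ≡ + 5 / 8)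
corollary4p5 1 (s≤s ())
corollary4p5 2 (s≤s (s≤s ()))
-- ⅓↑ 0 = 1 is outside the range of m-⅛*, so n = 3 is evaluated directly.
corollary4p5 3 _ = refl , refl
corollary4p5 n@(suc (suc (suc (suc k)))) _ = m-y-2y k , (begin
  m n (½ - y n)                   ≡⟨ m-[½-x] (3 ℕ.+ k) (y∈[0,½⟩ k) ⟩
  m n (y n) + (½ - 2ℚ * y n)      ≡⟨ regroup (m n (y n)) (y n) ⟩
  (m n (y n) - 2ℚ * y n) + ½      ≡⟨ cong (_+ ½) (m-y-2y k) ⟩
  ⅛ + ½                           ∎)
  where
  open ≡-Reasoning
  regroup : ∀ a b → a + (½ - 2ℚ * b) ≡ (a - 2ℚ * b) + ½
  regroup = solve-∀ ℚ-ring
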